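{- Let $n \ge 3$ and let $S$ be a sequence over the cyclic group $C_n$ such that $0$ is not a term of $S$ and $N_0(S) = 2^{|S|-n+1}$. Then $n-1 \le |S| \le n$ and $S = a^{|S|}$ for some element $a$ generating $C_n$.
   Context: A sequence over $G$ is a finite unordered list $S = g_1 \cdots g_m$ of elements of $G$ with repetition allowed; $|S|=m$; $a^k$ denotes the sequence consisting of $k$ copies of $a$. $N_0(S) = |\{I \subseteq [1,m] : \sum_{i\in I} g_i = 0\}|$, the number of subsequences (counted by index sets, the empty one included) with sum $0$. -}

module Defs where

open import Data.Nat using (ℕ; zero; suc; _+_; NonZero)
open import Data.Nat.DivMod using (_mod_)
open import Data.Nat.GCD using (gcd)
open import Data.Fin using (Fin; toℕ)
open import Data.List using (List; []; _∷_)
open import Relation.Binary.PropositionalEquality using (_≡_)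
open import Relation.Nullary using (does)
open import Data.Fin.Properties using (_≟_)
open import Data.Bool using (if_then_else_)

-- The cyclic group C_n modelled as Fin n (integers 0..n-1) under addition mod n.
-- Zero element.
𝟘 : ∀ {n} .{{_ : NonZero n}} → Fin n
𝟘 {n} = 0 mod n

_⊕_ : ∀ {n} .{{_ : NonZero n}} → Fin n → Fin n → Fin n
_⊕_ {n} a b = (toℕ a + toℕ b) mod n

-- A sequence over C_n: a finite list of elements (order irrelevant).
Seq : ℕ → Set
Seq n = List (Fin n)

subsetsSumming : ∀ {n} .{{_ : NonZero n}} → Fin n → Seq n → Fin n → ℕ
subsetsSumming acc []      t = if does (acc ≟ t) then 1 else 0
subsetsSumming acc (g ∷ S) t = subsetsSumming acc S t + subsetsSumming (acc ⊕ g) S t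

-- N₀ S: number of index subsets I ⊆ [1,|S|] (empty set included) with Σ_{i∈I} g_i = 0.
N₀ : ∀ {n} .{{_ : NonZero n}} → Seq n → ℕ
N₀ S = subsetsSumming 𝟘 S 𝟘

Generates : ∀ {n} → Fin n → Set
Generates {n} a = gcd (toℕ a) n ≡ 1

-- Write N S t for the number of subsequences of S with sum t, and Σ(S) for the set of t with N S t ≥ 1.
-- Prepending a term g to S either doubles a count (when both t and t − g are sums of S) or enlarges
-- Σ(S): if t ∈ Σ(S) but t − g ∉ Σ(S), then, g having finite order, some u ∉ Σ(S) has u − g ∈ Σ(S).
-- Hence 2^(|S|+1) ≤ 2^|Σ(S)| · N S t ≤ 2^n · N S t for every sum t, and the hypothesis is the case
-- of equality at t = 0 ("extremal"). An extremal zero-sum free S has length n − 1, and counting the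
-- sums of S without two of its terms shows that all terms agree, with a generator as common value.
-- Otherwise some term x has −x among the sums of the remaining terms L; then L is extremal, so
-- L = a^k by induction, exchanging x with a copy of a shows x = a, and k = n is excluded because
-- a^(n+1) has at least n + 2 > 4 zero-sum subsequences.
module Submission where

open import Algebra.Bundles using (AbelianGroup)
open import Algebra.Structures using (IsAbelianGroup)
import Algebra.Definitions.RawMonoid as RawMonoidDefinitions
import Algebra.Properties.AbelianGroup as AbelianGroupProperties
import Algebra.Properties.CommutativeSemigroup as CommutativeSemigroupProperties
open import Data.Bool using (if_then_else_)
open import Data.Bool.Properties using (T-≡)
open import Data.Empty using (⊥-elim)
open import Data.Fin using (Fin; toℕ)
open import Data.Fin.Properties using (toℕ-fromℕ<; toℕ-injective; toℕ<n; _≟_; any?)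
open import Data.Fin.Subset using (Subset; _⊆_; _⊂_; ∣_∣; _∪_; ⁅_⁆) renaming (_∈_ to _∈ₛ_; _∉_ to _∉ₛ_)
open import Data.Fin.Subset.Properties
  using (∣p∣≤n; p⊆q⇒∣p∣≤∣q∣; p⊂q⇒∣p∣<∣q∣; x∈p⇒∣p-x∣<∣p∣; p⊆p∪q; x∈p∪q⁺; x∈p∪q⁻; x∈⁅x⁆; x∈⁅y⁆⇒x≡y)
open import Data.List using ([]; _∷_; _++_; length; replicate)
open import Data.List.Membership.Propositional using (_∈_; _∉_)
open import Data.List.Membership.Propositional.Properties using (∈-∃++)
open import Data.List.Properties using (length-replicate; ∷-injectiveˡ; ∷-injectiveʳ)
open import Data.List.Relation.Binary.Permutation.Propositional as ↭ using (_↭_; ↭-sym)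
open import Data.List.Relation.Binary.Permutation.Propositional.Properties
  using (↭-length; All-resp-↭) renaming (shift to ↭-shift)
open import Data.List.Relation.Unary.All as All using (All; []; _∷_)
open import Data.List.Relation.Unary.All.Properties using (replicate⁺; ¬Any⇒All¬)
import Data.Nat as ℕ
open import Data.Nat
  using (ℕ; zero; suc; _+_; _*_; _∸_; _^_; _%_; _≤_; _<_; _≤?_; z≤n; s≤s; NonZero;
         >-nonZero⁻¹; ≢-nonZero; ≢-nonZero⁻¹)
open import Data.Nat.Divisibility using (_∣_; divides)
open import Data.Nat.DivMod using (_mod_; %-distribˡ-+; m%n%n≡m%n; m<n⇒m%n≡m; n%n≡0; m*n%n≡0)
open import Data.Nat.GCD using (gcd; gcd[m,n]∣m; gcd[m,n]∣n)
open import Data.Nat.Properties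
  using (module ≤-Reasoning; +-comm; +-assoc; +-identityʳ; +-mono-≤; +-monoʳ-≤; +-cancelʳ-≤;
         +-commutativeSemigroup; *-comm; *-assoc; *-identityʳ; *-zeroʳ; *-distribˡ-+; *-mono-≤;
         *-monoʳ-≤; *-monoˡ-≤; *-cancelˡ-≡; ^-monoʳ-≤; ^-monoʳ-<; m^n≢0; ≤-refl; ≤-reflexive;
         ≤-trans; ≤-antisym; ≤-pred; <⇒≤; <⇒≱; ≰⇒>; ≤∧≢⇒<; 1+n≰n; n<1⇒n≡0; n≢0⇒n>0; m≤m+n;
         m≤n+m; m<m*n; m+[n∸m]≡n; m∸n≤m; m≤n⇒∃[o]m+o≡n; suc-injective)
open import Data.Product using (_,_; _×_; ∃-syntax)
open import Data.Sum using (_⊎_; inj₁; inj₂; [_,_])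
open import Data.Vec using (tabulate)
open import Data.Vec.Properties using (lookup∘tabulate; []=⇒lookup; lookup⇒[]=)
open import Function using (_∘_)
open import Function.Bundles using (_⇔_; mk⇔; Equivalence)
open import Level using (0ℓ)
open import Relation.Binary.PropositionalEquality
  using (_≡_; _≢_; refl; sym; trans; cong; cong₂; subst; subst₂; isEquivalence; module ≡-Reasoning)
open import Relation.Nullary using (¬_; yes; no; does; isYes; toWitness; fromWitness; ¬?; _×-dec_)
open import Relation.Nullary.Decidable using (does-⇔; dec-true)
open import Relation.Unary using (Pred; Decidable)

open import Defs

open Equivalence using (to; from)
open CommutativeSemigroupProperties +-commutativeSemigroup using () renaming (interchange to +-interchange)

[m%d+o]%d≡[m+o]%d : ∀ m o d .{{_ : NonZero d}} → (m % d + o) % d ≡ (m + o) % d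
[m%d+o]%d≡[m+o]%d m o d = begin
  (m % d + o) % d          ≡⟨ %-distribˡ-+ (m % d) o d ⟩
  (m % d % d + o % d) % d  ≡⟨ cong (λ z → (z + o % d) % d) (m%n%n≡m%n m d) ⟩
  (m % d + o % d) % d      ≡⟨ %-distribˡ-+ m o d ⟨
  (m + o) % d              ∎
  where open ≡-Reasoning

[m+o%d]%d≡[m+o]%d : ∀ m o d .{{_ : NonZero d}} → (m + o % d) % d ≡ (m + o) % d
[m+o%d]%d≡[m+o]%d m o d = begin
  (m + o % d) % d  ≡⟨ cong (_% d) (+-comm m (o % d)) ⟩
  (o % d + m) % d  ≡⟨ [m%d+o]%d≡[m+o]%d o m d ⟩
  (o + m) % d      ≡⟨ cong (_% d) (+-comm o m) ⟩
  (m + o) % d      ∎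
  where open ≡-Reasoning

2*m≡m+m : ∀ m → 2 * m ≡ m + m
2*m≡m+m m = cong (m +_) (+-identityʳ m)

2^-reflects-≤ : ∀ {m k} → 2 ^ m ≤ 2 ^ k → m ≤ k
2^-reflects-≤ {m} {k} 2^m≤2^k with m ≤? k
... | yes m≤k = m≤k
... | no  m≰k = ⊥-elim (<⇒≱ (^-monoʳ-< 2 (s≤s (s≤s z≤n)) (≰⇒> m≰k)) 2^m≤2^k)

2^-injective : ∀ {m k} → 2 ^ m ≡ 2 ^ k → m ≡ k
2^-injective eq = ≤-antisym (2^-reflects-≤ (≤-reflexive eq)) (2^-reflects-≤ (≤-reflexive (sym eq)))

m≤n⇒m≤o⇒n+o≡m+m⇒n≡m : ∀ {m n o} → m ≤ n → m ≤ o → n + o ≡ m + m → n ≡ m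
m≤n⇒m≤o⇒n+o≡m+m⇒n≡m {m} {n} m≤n m≤o eq =
  ≤-antisym (+-cancelʳ-≤ m n m (≤-trans (+-monoʳ-≤ n m≤o) (≤-reflexive eq))) m≤n

k≤m+n∧1≰n⇒k≤m : ∀ {k m n} → k ≤ m + n → ¬ 1 ≤ n → k ≤ m
k≤m+n∧1≰n⇒k≤m {m = m} k≤m+n 1≰n =
  ≤-trans k≤m+n (≤-reflexive (trans (cong (m +_) (n<1⇒n≡0 (≰⇒> 1≰n))) (+-identityʳ m)))

split-sum≡1 : ∀ {a b c d} → 1 ≤ a → a + b + (c + d) ≡ 1 → a ≡ 1 × b ≡ 0 × c ≡ 0 × d ≡ 0
split-sum≡1 {1} {0} {0} {0} _ _ = refl , refl , refl , refl

∈-tabulate-isYes : ∀ {m p} {P : Pred (Fin m) p} (P? : Decidable P) {u : Fin m} →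
                   u ∈ₛ tabulate (isYes ∘ P?) ⇔ P u
∈-tabulate-isYes P? {u} = mk⇔
  (λ u∈ → toWitness (from T-≡ (trans (sym (lookup∘tabulate _ u)) ([]=⇒lookup u∈))))
  (λ Pu → lookup⇒[]= u _ (trans (lookup∘tabulate _ u) (to T-≡ (fromWitness Pu))))

∈⇒∣p∣>0 : ∀ {m} {p : Subset m} {x} → x ∈ₛ p → 1 ≤ ∣ p ∣
∈⇒∣p∣>0 x∈p = ≤-trans (s≤s z≤n) (x∈p⇒∣p-x∣<∣p∣ x∈p)

∉⇒∣p∣<∣p∪⁅x⁆∣ : ∀ {m} {p : Subset m} {x} → x ∉ₛ p → ∣ p ∣ < ∣ p ∪ ⁅ x ⁆ ∣
∉⇒∣p∣<∣p∪⁅x⁆∣ {x = x} x∉p = p⊂q⇒∣p∣<∣q∣ (p⊆p∪q ⁅ x ⁆ , x , x∈p∪q⁺ (inj₂ (x∈⁅x⁆ x)) , x∉p)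

∉-∪⁅⁆ : ∀ {m} {p : Subset m} {x y} → x ∉ₛ p → x ≢ y → x ∉ₛ p ∪ ⁅ y ⁆
∉-∪⁅⁆ {p = p} {y = y} x∉p x≢y x∈ = [ x∉p , x≢y ∘ x∈⁅y⁆⇒x≡y y ] (x∈p∪q⁻ p ⁅ y ⁆ x∈)

three-∉⇒3+∣p∣≤m : ∀ {m} {p : Subset m} {x y z} → x ∉ₛ p → y ∉ₛ p → z ∉ₛ p →
                  x ≢ y → x ≢ z → y ≢ z → 3 + ∣ p ∣ ≤ m
three-∉⇒3+∣p∣≤m {m} {p} {x} {y} {z} x∉ y∉ z∉ x≢y x≢z y≢z = begin
  3 + ∣ p ∣                          ≤⟨ s≤s (s≤s (∉⇒∣p∣<∣p∪⁅x⁆∣ x∉)) ⟩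
  2 + ∣ p ∪ ⁅ x ⁆ ∣                  ≤⟨ s≤s (∉⇒∣p∣<∣p∪⁅x⁆∣ (∉-∪⁅⁆ y∉ (x≢y ∘ sym))) ⟩
  1 + ∣ (p ∪ ⁅ x ⁆) ∪ ⁅ y ⁆ ∣        ≤⟨ ∉⇒∣p∣<∣p∪⁅x⁆∣ z∉p∪x∪y ⟩
  ∣ ((p ∪ ⁅ x ⁆) ∪ ⁅ y ⁆) ∪ ⁅ z ⁆ ∣  ≤⟨ ∣p∣≤n (((p ∪ ⁅ x ⁆) ∪ ⁅ y ⁆) ∪ ⁅ z ⁆) ⟩
  m                                  ∎
  where
  open ≤-Reasoning
  z∉p∪x∪y : z ∉ₛ (p ∪ ⁅ x ⁆) ∪ ⁅ y ⁆
  z∉p∪x∪y = ∉-∪⁅⁆ {p = p ∪ ⁅ x ⁆} (∉-∪⁅⁆ {p = p} z∉ (x≢z ∘ sym)) (y≢z ∘ sym)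

∈⇒↭ : ∀ {a} {A : Set a} {x : A} {xs} → x ∈ xs → ∃[ ys ] xs ↭ x ∷ ys
∈⇒↭ {x = x} x∈xs with ys , zs , refl ← ∈-∃++ x∈xs = ys ++ zs , ↭-shift x ys zs

All-≡⇒≡replicate : ∀ {a} {A : Set a} {x : A} {xs} → All (_≡ x) xs → xs ≡ replicate (length xs) x
All-≡⇒≡replicate []          = refl
All-≡⇒≡replicate (refl ∷ xs) = cong (_ ∷_) (All-≡⇒≡replicate xs)

↭-replicate⇒≡ : ∀ {a} {A : Set a} {x : A} {xs} k → xs ↭ replicate k x → xs ≡ replicate k x
↭-replicate⇒≡ {x = x} k xs↭ =
  trans (All-≡⇒≡replicate (All-resp-↭ (↭-sym xs↭) (replicate⁺ k refl)))
        (cong (λ j → replicate j x) (trans (↭-length xs↭) (length-replicate k)))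

module _ {n : ℕ} .{{_ : NonZero n}} where

  -- The cyclic group C_n

  toℕ-⊕ : (a b : Fin n) → toℕ (a ⊕ b) ≡ (toℕ a + toℕ b) % n
  toℕ-⊕ a b = toℕ-fromℕ< _

  toℕ-𝟘 : toℕ (𝟘 {n}) ≡ 0
  toℕ-𝟘 = trans (toℕ-fromℕ< _) (m<n⇒m%n≡m (>-nonZero⁻¹ n))

  ⊖_ : Fin n → Fin n
  ⊖ a = (n ∸ toℕ a) mod n

  ⊕-comm : (a b : Fin n) → a ⊕ b ≡ b ⊕ a
  ⊕-comm a b = toℕ-injective (begin
    toℕ (a ⊕ b)          ≡⟨ toℕ-⊕ a b ⟩
    (toℕ a + toℕ b) % n  ≡⟨ cong (_% n) (+-comm (toℕ a) (toℕ b)) ⟩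
    (toℕ b + toℕ a) % n  ≡⟨ toℕ-⊕ b a ⟨
    toℕ (b ⊕ a)          ∎)
    where open ≡-Reasoning

  ⊕-assoc : (a b c : Fin n) → (a ⊕ b) ⊕ c ≡ a ⊕ (b ⊕ c)
  ⊕-assoc a b c = toℕ-injective (begin
    toℕ ((a ⊕ b) ⊕ c)                  ≡⟨ toℕ-⊕ (a ⊕ b) c ⟩
    (toℕ (a ⊕ b) + toℕ c) % n          ≡⟨ cong (λ z → (z + toℕ c) % n) (toℕ-⊕ a b) ⟩
    ((toℕ a + toℕ b) % n + toℕ c) % n  ≡⟨ [m%d+o]%d≡[m+o]%d (toℕ a + toℕ b) (toℕ c) n ⟩
    (toℕ a + toℕ b + toℕ c) % n        ≡⟨ cong (_% n) (+-assoc (toℕ a) (toℕ b) (toℕ c)) ⟩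
    (toℕ a + (toℕ b + toℕ c)) % n      ≡⟨ [m+o%d]%d≡[m+o]%d (toℕ a) (toℕ b + toℕ c) n ⟨
    (toℕ a + (toℕ b + toℕ c) % n) % n  ≡⟨ cong (λ z → (toℕ a + z) % n) (toℕ-⊕ b c) ⟨
    (toℕ a + toℕ (b ⊕ c)) % n          ≡⟨ toℕ-⊕ a (b ⊕ c) ⟨
    toℕ (a ⊕ (b ⊕ c))                  ∎)
    where open ≡-Reasoning

  ⊕-identityˡ : (a : Fin n) → 𝟘 ⊕ a ≡ a
  ⊕-identityˡ a = toℕ-injective (begin
    toℕ (𝟘 ⊕ a)                ≡⟨ toℕ-⊕ 𝟘 a ⟩
    (toℕ (𝟘 {n}) + toℕ a) % n  ≡⟨ cong (λ z → (z + toℕ a) % n) toℕ-𝟘 ⟩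
    toℕ a % n                  ≡⟨ m<n⇒m%n≡m (toℕ<n a) ⟩
    toℕ a                      ∎)
    where open ≡-Reasoning

  ⊕-inverseʳ : (a : Fin n) → a ⊕ (⊖ a) ≡ 𝟘
  ⊕-inverseʳ a = toℕ-injective (begin
    toℕ (a ⊕ (⊖ a))                ≡⟨ toℕ-⊕ a (⊖ a) ⟩
    (toℕ a + toℕ (⊖ a)) % n        ≡⟨ cong (λ z → (toℕ a + z) % n) (toℕ-fromℕ< _) ⟩
    (toℕ a + (n ∸ toℕ a) % n) % n  ≡⟨ [m+o%d]%d≡[m+o]%d (toℕ a) (n ∸ toℕ a) n ⟩
    (toℕ a + (n ∸ toℕ a)) % n      ≡⟨ cong (_% n) (m+[n∸m]≡n (<⇒≤ (toℕ<n a))) ⟩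
    n % n                          ≡⟨ n%n≡0 n ⟩
    0                              ≡⟨ toℕ-𝟘 ⟨
    toℕ (𝟘 {n})                    ∎)
    where open ≡-Reasoning

  ⊕-isAbelianGroup : IsAbelianGroup _≡_ _⊕_ 𝟘 ⊖_
  ⊕-isAbelianGroup = record
    { isGroup = record
      { isMonoid = record
        { isSemigroup = record
          { isMagma = record { isEquivalence = isEquivalence ; ∙-cong = cong₂ _⊕_ }
          ; assoc = ⊕-assoc
          }
        ; identity = ⊕-identityˡ , λ a → trans (⊕-comm a 𝟘) (⊕-identityˡ a)
        }
      ; inverse = (λ a → trans (⊕-comm (⊖ a) a) (⊕-inverseʳ a)) , ⊕-inverseʳ
      ; ⁻¹-cong = cong ⊖_
      }
    ; comm = ⊕-comm
    }

  Cₙ : AbelianGroup 0ℓ 0ℓ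
  Cₙ = record { isAbelianGroup = ⊕-isAbelianGroup }

  open AbelianGroup Cₙ using (identityʳ)
  open AbelianGroupProperties Cₙ
  open CommutativeSemigroupProperties (AbelianGroup.commutativeSemigroup Cₙ) using (xy∙z≈xz∙y; x∙yz≈xz∙y)
  open RawMonoidDefinitions (AbelianGroup.rawMonoid Cₙ) using () renaming (_×_ to _·_)

  infixl 6 _⊖_
  _⊖_ : Fin n → Fin n → Fin n
  a ⊖ b = a ⊕ (⊖ b)

  ⊖-swap : (t a b : Fin n) → t ⊖ a ⊖ b ≡ t ⊖ b ⊖ a
  ⊖-swap t a b = xy∙z≈xz∙y t (⊖ a) (⊖ b)

  ⊖-⊕ : (t a b : Fin n) → t ⊖ (a ⊕ b) ≡ t ⊖ a ⊖ b
  ⊖-⊕ t a b = trans (cong (t ⊕_) (sym (⁻¹-∙-comm a b))) (sym (⊕-assoc t (⊖ a) (⊖ b)))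

  ≡⇔⊖≡𝟘 : {a b : Fin n} → a ≡ b ⇔ b ⊖ a ≡ 𝟘
  ≡⇔⊖≡𝟘 {a} {b} = mk⇔ (λ a≡b → x≈y⇒x∙y⁻¹≈ε (sym a≡b)) (λ b⊖a≡𝟘 → sym (x∙y⁻¹≈ε⇒x≈y b a b⊖a≡𝟘))

  a≡a⊖b⇒b≡𝟘 : {a b : Fin n} → a ≡ a ⊖ b → b ≡ 𝟘
  a≡a⊖b⇒b≡𝟘 {a} {b} eq = ⁻¹-injective (trans (identityʳ-unique a (⊖ b) (sym eq)) (sym ε⁻¹≈ε))

  𝟘⊖-injective : {a b : Fin n} → 𝟘 ⊖ a ≡ 𝟘 ⊖ b → a ≡ b
  𝟘⊖-injective {a} {b} eq = ⁻¹-injective (∙-cancelˡ 𝟘 (⊖ a) (⊖ b) eq)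

  toℕ-· : (m : ℕ) (a : Fin n) → toℕ (m · a) ≡ (m * toℕ a) % n
  toℕ-· zero    a = toℕ-fromℕ< _
  toℕ-· (suc m) a = begin
    toℕ (a ⊕ (m · a))            ≡⟨ toℕ-⊕ a (m · a) ⟩
    (toℕ a + toℕ (m · a)) % n    ≡⟨ cong (λ z → (toℕ a + z) % n) (toℕ-· m a) ⟩
    (toℕ a + m * toℕ a % n) % n  ≡⟨ [m+o%d]%d≡[m+o]%d (toℕ a) (m * toℕ a) n ⟩
    (suc m * toℕ a) % n          ∎
    where open ≡-Reasoning

  n∣m*a⇒m·a≡𝟘 : (m : ℕ) (a : Fin n) → n ∣ m * toℕ a → m · a ≡ 𝟘
  n∣m*a⇒m·a≡𝟘 m a (divides k eq) = toℕ-injective (begin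
    toℕ (m · a)      ≡⟨ toℕ-· m a ⟩
    (m * toℕ a) % n  ≡⟨ cong (_% n) eq ⟩
    (k * n) % n      ≡⟨ m*n%n≡0 k n ⟩
    0                ≡⟨ toℕ-𝟘 ⟨
    toℕ (𝟘 {n})      ∎)
    where open ≡-Reasoning

  n·a≡𝟘 : (a : Fin n) → n · a ≡ 𝟘
  n·a≡𝟘 a = n∣m*a⇒m·a≡𝟘 n a (divides (toℕ a) (*-comm n (toℕ a)))

  [1+m]·a⊖a≡m·a : (m : ℕ) (a : Fin n) → suc m · a ⊖ a ≡ m · a
  [1+m]·a⊖a≡m·a m a = trans (cong (_⊖ a) (⊕-comm a (m · a))) (//-rightDividesʳ a (m · a))

  suc[n∸1]≡n : suc (n ∸ 1) ≡ n
  suc[n∸1]≡n = m+[n∸m]≡n (>-nonZero⁻¹ n)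

  [n∸1]·a≡⊖a : (a : Fin n) → (n ∸ 1) · a ≡ ⊖ a
  [n∸1]·a≡⊖a a = inverseʳ-unique a ((n ∸ 1) · a) (trans (cong (_· a) suc[n∸1]≡n) (n·a≡𝟘 a))

  ¬generates⇒small-order : ∀ a → ¬ Generates a → ∃[ q ] 1 ≤ q × q < n × q · a ≡ 𝟘
  ¬generates⇒small-order a ¬gen with gcd[m,n]∣n (toℕ a) n | gcd[m,n]∣m (toℕ a) n
  ... | divides q n≡q*d | divides p a≡p*d = q , n≢0⇒n>0 q≢0 , q<n , n∣m*a⇒m·a≡𝟘 q a (divides p q*a≡p*n)
    where
    d = gcd (toℕ a) n
    q≢0 : q ≢ 0
    q≢0 refl = ≢-nonZero⁻¹ n n≡q*d
    d≢0 : d ≢ 0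
    d≢0 d≡0 = ≢-nonZero⁻¹ n (trans n≡q*d (trans (cong (q *_) d≡0) (*-zeroʳ q)))
    q<n : q < n
    q<n = subst (q <_) (sym n≡q*d) (m<m*n q d {{≢-nonZero q≢0}} (≤∧≢⇒< (n≢0⇒n>0 d≢0) (¬gen ∘ sym)))
    q*a≡p*n : q * toℕ a ≡ p * n
    q*a≡p*n = begin
      q * toℕ a    ≡⟨ cong (q *_) a≡p*d ⟩
      q * (p * d)  ≡⟨ *-assoc q p d ⟨
      q * p * d    ≡⟨ cong (_* d) (*-comm q p) ⟩
      p * q * d    ≡⟨ *-assoc p q d ⟩
      p * (q * d)  ≡⟨ cong (p *_) n≡q*d ⟨
      p * n        ∎
      where open ≡-Reasoning

  -- Counting subsequence sums

  N : Seq n → Fin n → ℕ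
  N []      t = if does (t ≟ 𝟘) then 1 else 0
  N (g ∷ S) t = N S t + N S (t ⊖ g)

  subsetsSumming≡N : ∀ acc S t → subsetsSumming acc S t ≡ N S (t ⊖ acc)
  subsetsSumming≡N acc []      t =
    cong (λ b → if b then 1 else 0) (does-⇔ ≡⇔⊖≡𝟘 (acc ≟ t) (t ⊖ acc ≟ 𝟘))
  subsetsSumming≡N acc (g ∷ S) t = cong₂ _+_ (subsetsSumming≡N acc S t)
    (trans (subsetsSumming≡N (acc ⊕ g) S t) (cong (N S) (⊖-⊕ t acc g)))

  N₀≡N𝟘 : ∀ S → N₀ S ≡ N S 𝟘
  N₀≡N𝟘 S = trans (subsetsSumming≡N 𝟘 S 𝟘) (cong (N S) (⊕-inverseʳ 𝟘))

  N-∷ˡ : ∀ g S t → N S t ≤ N (g ∷ S) t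
  N-∷ˡ g S t = m≤m+n _ _

  N-∷ʳ : ∀ g S t → N S (t ⊖ g) ≤ N (g ∷ S) t
  N-∷ʳ g S t = m≤n+m _ _

  N[]𝟘≡1 : N [] 𝟘 ≡ 1
  N[]𝟘≡1 rewrite dec-true (𝟘 {n} ≟ 𝟘) refl = refl

  1≤N[]⇒≡𝟘 : ∀ {t} → 1 ≤ N [] t → t ≡ 𝟘
  1≤N[]⇒≡𝟘 {t} with t ≟ 𝟘
  ... | yes t≡𝟘 = λ _ → t≡𝟘

  1≤N-𝟘 : ∀ S → 1 ≤ N S 𝟘
  1≤N-𝟘 []      = ≤-reflexive (sym N[]𝟘≡1)
  1≤N-𝟘 (g ∷ S) = ≤-trans (1≤N-𝟘 S) (N-∷ˡ g S 𝟘)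

  N-∷-cong : ∀ g {S S′} → (∀ t → N S t ≡ N S′ t) → ∀ t → N (g ∷ S) t ≡ N (g ∷ S′) t
  N-∷-cong g S≗S′ t = cong₂ _+_ (S≗S′ t) (S≗S′ (t ⊖ g))

  N-swap : ∀ g h S t → N (g ∷ h ∷ S) t ≡ N (h ∷ g ∷ S) t
  N-swap g h S t = trans (+-interchange (N S t) _ _ _)
    (cong (λ u → N S t + N S (t ⊖ g) + (N S (t ⊖ h) + N S u)) (⊖-swap t g h))

  N-resp-↭ : ∀ {S S′} → S ↭ S′ → ∀ t → N S t ≡ N S′ t
  N-resp-↭ ↭.refl                      t = refl
  N-resp-↭ (↭.prep {S} {S′} g S↭S′)   t = N-∷-cong g {S} {S′} (N-resp-↭ S↭S′) t
  N-resp-↭ (↭.swap {S} {S′} g h S↭S′) t =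
    trans (N-swap g h S t) (N-∷-cong h {g ∷ S} {g ∷ S′} (N-∷-cong g {S} {S′} (N-resp-↭ S↭S′)) t)
  N-resp-↭ (↭.trans S↭S′ S′↭S″)        t = trans (N-resp-↭ S↭S′ t) (N-resp-↭ S′↭S″ t)

  sums : Seq n → Subset n
  sums S = tabulate (isYes ∘ λ u → 1 ≤? N S u)

  ∈-sums : ∀ S {u} → u ∈ₛ sums S ⇔ 1 ≤ N S u
  ∈-sums S = ∈-tabulate-isYes (λ u → 1 ≤? N S u)

  sums-⊆ : ∀ g S → sums S ⊆ sums (g ∷ S)
  sums-⊆ g S {u} u∈ = from (∈-sums (g ∷ S)) (≤-trans (to (∈-sums S) u∈) (N-∷ˡ g S u))

  sums-⊂ : ∀ g S {u} → ¬ 1 ≤ N S u → 1 ≤ N S (u ⊖ g) → sums S ⊂ sums (g ∷ S)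
  sums-⊂ g S {u} 1≰N 1≤N[u⊖g] =
    sums-⊆ g S , u , from (∈-sums (g ∷ S)) (≤-trans 1≤N[u⊖g] (N-∷ʳ g S u)) , 1≰N ∘ to (∈-sums S)

  -- If P were closed under u ↦ u ⊕ g, then P t would give P (t ⊕ (n ∸ 1) · g) = P (t ⊖ g).
  translation-boundary : ∀ {p} {P : Pred (Fin n) p} → Decidable P → ∀ g {t} → P t → ¬ P (t ⊖ g) →
                         ∃[ u ] ¬ P u × P (u ⊖ g)
  translation-boundary {P = P} P? g {t} Pt ¬P[t⊖g] with any? (λ u → ¬? (P? u) ×-dec P? (u ⊖ g))
  ... | yes boundary = boundary
  ... | no ¬boundary = ⊥-elim (¬P[t⊖g] (subst P (cong (t ⊕_) ([n∸1]·a≡⊖a g)) (closed (n ∸ 1))))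
    where
    step : ∀ {v} → P v → P (v ⊕ g)
    step {v} Pv with P? (v ⊕ g)
    ... | yes P[v⊕g] = P[v⊕g]
    ... | no ¬P[v⊕g] = ⊥-elim (¬boundary (v ⊕ g , ¬P[v⊕g] , subst P (sym (//-rightDividesʳ g v)) Pv))
    closed : ∀ k → P (t ⊕ (k · g))
    closed zero    = subst P (sym (identityʳ t)) Pt
    closed (suc k) = subst P (sym (x∙yz≈xz∙y t g (k · g))) (step (closed k))

  sums-⊂-boundary : ∀ g S {t} → 1 ≤ N S t → ¬ 1 ≤ N S (t ⊖ g) → sums S ⊂ sums (g ∷ S)
  sums-⊂-boundary g S 1≤N 1≰N with _ , 1≰N[u] , 1≤N[u⊖g] ← translation-boundary (λ u → 1 ≤? N S u) g 1≤N 1≰N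
    = sums-⊂ g S 1≰N[u] 1≤N[u⊖g]

  N-lower-bound-step-⊂ : ∀ g S {s t} → 2 ^ suc (length S) ≤ 2 ^ ∣ sums S ∣ * N S s →
                         N S s ≤ N (g ∷ S) t → sums S ⊂ sums (g ∷ S) →
                         2 ^ suc (length (g ∷ S)) ≤ 2 ^ ∣ sums (g ∷ S) ∣ * N (g ∷ S) t
  N-lower-bound-step-⊂ g S {s} {t} bound N≤ S⊂ = begin
    2 * 2 ^ suc (length S)              ≤⟨ *-monoʳ-≤ 2 bound ⟩
    2 * (2 ^ ∣ sums S ∣ * N S s)        ≡⟨ *-assoc 2 (2 ^ ∣ sums S ∣) (N S s) ⟨
    2 ^ suc ∣ sums S ∣ * N S s          ≤⟨ *-mono-≤ (^-monoʳ-≤ 2 (p⊂q⇒∣p∣<∣q∣ S⊂)) N≤ ⟩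
    2 ^ ∣ sums (g ∷ S) ∣ * N (g ∷ S) t  ∎
    where open ≤-Reasoning

  N-lower-bound : ∀ S {t} → 1 ≤ N S t → 2 ^ suc (length S) ≤ 2 ^ ∣ sums S ∣ * N S t
  N-lower-bound []      {t} 1≤N = *-mono-≤ (^-monoʳ-≤ 2 (∈⇒∣p∣>0 (from (∈-sums [] {t}) 1≤N))) 1≤N
  N-lower-bound (g ∷ S) {t} 1≤N with 1 ≤? N S t | 1 ≤? N S (t ⊖ g)
  ... | yes p | yes q = begin
    2 * 2 ^ suc (length S)                   ≡⟨ 2*m≡m+m (2 ^ suc (length S)) ⟩
    2 ^ suc (length S) + 2 ^ suc (length S)  ≤⟨ +-mono-≤ (N-lower-bound S p) (N-lower-bound S q) ⟩
    2 ^ c * N S t + 2 ^ c * N S (t ⊖ g)      ≡⟨ *-distribˡ-+ (2 ^ c) (N S t) (N S (t ⊖ g)) ⟨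
    2 ^ c * N (g ∷ S) t                      ≤⟨ *-monoˡ-≤ _ (^-monoʳ-≤ 2 (p⊆q⇒∣p∣≤∣q∣ (sums-⊆ g S))) ⟩
    2 ^ ∣ sums (g ∷ S) ∣ * N (g ∷ S) t       ∎
    where
    open ≤-Reasoning
    c = ∣ sums S ∣
  ... | yes p | no ¬q = N-lower-bound-step-⊂ g S (N-lower-bound S p) (N-∷ˡ g S t) (sums-⊂-boundary g S p ¬q)
  ... | no ¬p | yes q = N-lower-bound-step-⊂ g S (N-lower-bound S q) (N-∷ʳ g S t) (sums-⊂ g S ¬p q)
  ... | no ¬p | no ¬q = ⊥-elim (¬p (k≤m+n∧1≰n⇒k≤m 1≤N ¬q))

  N-lower-bound-n : ∀ S {t} → 1 ≤ N S t → 2 ^ suc (length S) ≤ 2 ^ n * N S t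
  N-lower-bound-n S {t} 1≤N =
    ≤-trans (N-lower-bound S 1≤N) (*-monoˡ-≤ (N S t) (^-monoʳ-≤ 2 (∣p∣≤n (sums S))))

  ZeroSumFree : Seq n → Set
  ZeroSumFree S = N S 𝟘 ≡ 1

  zsf⇒length<∣sums∣ : ∀ S → ZeroSumFree S → suc (length S) ≤ ∣ sums S ∣
  zsf⇒length<∣sums∣ S zsf = 2^-reflects-≤ (begin
    2 ^ suc (length S)      ≤⟨ N-lower-bound S (1≤N-𝟘 S) ⟩
    2 ^ ∣ sums S ∣ * N S 𝟘  ≡⟨ cong (2 ^ ∣ sums S ∣ *_) zsf ⟩
    2 ^ ∣ sums S ∣ * 1      ≡⟨ *-identityʳ _ ⟩
    2 ^ ∣ sums S ∣          ∎)
    where open ≤-Reasoning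

  -- −y, −x and −x−y are distinct non-sums of T, which already has n − 2 sums.
  zsf-pair-equal : ∀ {x y T} → x ≢ 𝟘 → y ≢ 𝟘 → ZeroSumFree (x ∷ y ∷ T) → 3 + length T ≡ n → x ≡ y
  zsf-pair-equal {x} {y} {T} x≢𝟘 y≢𝟘 zsf len with x ≟ y
  ... | yes x≡y = x≡y
  ... | no  x≢y with zsfT , Ny≡0 , Nx≡0 , Nxy≡0 ← split-sum≡1 (1≤N-𝟘 T) zsf = ⊥-elim (1+n≰n (begin
    suc (3 + length T)  ≤⟨ +-monoʳ-≤ 3 (zsf⇒length<∣sums∣ T zsfT) ⟩
    3 + ∣ sums T ∣      ≤⟨ three-∉⇒3+∣p∣≤m (∉sums Ny≡0) (∉sums Nx≡0) (∉sums Nxy≡0) y≢x y≢xy x≢xy ⟩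
    n                   ≡⟨ len ⟨
    3 + length T        ∎))
    where
    open ≤-Reasoning
    ∉sums : ∀ {u} → N T u ≡ 0 → u ∉ₛ sums T
    ∉sums N≡0 u∈ = 1+n≰n (subst (1 ≤_) N≡0 (to (∈-sums T) u∈))
    y≢x : 𝟘 ⊖ y ≢ 𝟘 ⊖ x
    y≢x eq = x≢y (sym (𝟘⊖-injective eq))
    y≢xy : 𝟘 ⊖ y ≢ 𝟘 ⊖ x ⊖ y
    y≢xy eq = x≢𝟘 (a≡a⊖b⇒b≡𝟘 (trans eq (⊖-swap 𝟘 x y)))
    x≢xy : 𝟘 ⊖ x ≢ 𝟘 ⊖ x ⊖ y
    x≢xy eq = y≢𝟘 (a≡a⊖b⇒b≡𝟘 eq)

  zsf-constant : ∀ {x R} → All (_≢ 𝟘) (x ∷ R) → ZeroSumFree (x ∷ R) → suc (length (x ∷ R)) ≡ n →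
                 All (_≡ x) (x ∷ R)
  zsf-constant {x} {R} (x≢𝟘 ∷ R≢𝟘) zsf len = refl ∷ All.tabulate z≡x
    where
    z≡x : ∀ {z} → z ∈ R → z ≡ x
    z≡x z∈R with R₀ , R↭z∷R₀ ← ∈⇒↭ z∈R = sym (zsf-pair-equal {T = R₀} x≢𝟘 (All.lookup R≢𝟘 z∈R)
      (trans (sym (N-resp-↭ (↭.prep x R↭z∷R₀) 𝟘)) zsf)
      (trans (cong (2 +_) (sym (↭-length R↭z∷R₀))) len))

  1≤N-replicate-· : ∀ m a → 1 ≤ N (replicate m a) (m · a)
  1≤N-replicate-· zero    a = 1≤N-𝟘 []
  1≤N-replicate-· (suc m) a = ≤-trans
    (subst (λ u → 1 ≤ N (replicate m a) u) (sym ([1+m]·a⊖a≡m·a m a)) (1≤N-replicate-· m a))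
    (N-∷ʳ a (replicate m a) (suc m · a))

  N-replicate-drop-one : ∀ m a → suc m ≤ N (replicate (suc m) a) (m · a)
  N-replicate-drop-one zero    a = ≤-trans (1≤N-𝟘 []) (N-∷ˡ a [] 𝟘)
  N-replicate-drop-one (suc m) a = +-mono-≤ (1≤N-replicate-· (suc m) a)
    (subst (λ u → suc m ≤ N (replicate (suc m) a) u) (sym ([1+m]·a⊖a≡m·a m a)) (N-replicate-drop-one m a))

  2≤N-replicate : ∀ {q} m a → 1 ≤ q → q ≤ m → q · a ≡ 𝟘 → 2 ≤ N (replicate m a) 𝟘
  2≤N-replicate zero a 1≤q q≤0 _ = ⊥-elim (1+n≰n (≤-trans 1≤q q≤0))
  2≤N-replicate {q} (suc m) a 1≤q q≤1+m q·a≡𝟘 with q ≤? m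
  ... | yes q≤m = ≤-trans (2≤N-replicate m a 1≤q q≤m q·a≡𝟘) (N-∷ˡ a (replicate m a) 𝟘)
  ... | no  q≰m = +-mono-≤ (1≤N-𝟘 (replicate m a))
    (subst (λ u → 1 ≤ N (replicate m a) u) m·a≡𝟘⊖a (1≤N-replicate-· m a))
    where
    m·a≡𝟘⊖a : m · a ≡ 𝟘 ⊖ a
    m·a≡𝟘⊖a = begin
      m · a          ≡⟨ [1+m]·a⊖a≡m·a m a ⟨
      suc m · a ⊖ a  ≡⟨ cong (λ k → k · a ⊖ a) (≤-antisym q≤1+m (≰⇒> q≰m)) ⟨
      q · a ⊖ a      ≡⟨ cong (_⊖ a) q·a≡𝟘 ⟩
      𝟘 ⊖ a          ∎
      where open ≡-Reasoning

  N-replicate-peel : ∀ m a {s} → s ≢ 𝟘 → 1 ≤ N (replicate (suc m) a) s → 1 ≤ N (replicate m a) (s ⊖ a)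
  N-replicate-peel zero a {s} s≢𝟘 1≤N with 1 ≤? N [] (s ⊖ a)
  ... | yes q = q
  ... | no ¬q = ⊥-elim (s≢𝟘 (1≤N[]⇒≡𝟘 (k≤m+n∧1≰n⇒k≤m 1≤N ¬q)))
  N-replicate-peel (suc m) a {s} s≢𝟘 1≤N with 1 ≤? N (replicate (suc m) a) (s ⊖ a)
  ... | yes q = q
  ... | no ¬q = ⊥-elim (¬q (≤-trans (N-replicate-peel m a s≢𝟘 (k≤m+n∧1≰n⇒k≤m 1≤N ¬q))
                                     (N-∷ˡ a (replicate m a) (s ⊖ a))))

  zsf-replicate⇒generates : ∀ a → ZeroSumFree (replicate (n ∸ 1) a) → Generates a
  zsf-replicate⇒generates a zsf with gcd (toℕ a) n ℕ.≟ 1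
  ... | yes gen = gen
  ... | no ¬gen with q , 1≤q , q<n , q·a≡𝟘 ← ¬generates⇒small-order a ¬gen =
    ⊥-elim (1+n≰n (subst (2 ≤_) zsf (2≤N-replicate (n ∸ 1) a 1≤q q≤n∸1 q·a≡𝟘)))
    where
    q≤n∸1 : q ≤ n ∸ 1
    q≤n∸1 = ≤-pred (subst (_ ≤_) (sym suc[n∸1]≡n) q<n)

  -- Extremal sequences

  Extremal : Seq n → Set
  Extremal S = 2 ^ n * N S 𝟘 ≡ 2 ^ suc (length S)

  N₀-equation⇒extremal : ∀ S → N₀ S * 2 ^ (n ∸ 1) ≡ 2 ^ length S → Extremal S
  N₀-equation⇒extremal S eq = begin
    2 ^ n * N S 𝟘              ≡⟨ cong (λ k → 2 ^ k * N S 𝟘) suc[n∸1]≡n ⟨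
    2 * 2 ^ (n ∸ 1) * N S 𝟘    ≡⟨ *-assoc 2 (2 ^ (n ∸ 1)) (N S 𝟘) ⟩
    2 * (2 ^ (n ∸ 1) * N S 𝟘)  ≡⟨ cong (λ k → 2 * (2 ^ (n ∸ 1) * k)) (N₀≡N𝟘 S) ⟨
    2 * (2 ^ (n ∸ 1) * N₀ S)   ≡⟨ cong (2 *_) (trans (*-comm (2 ^ (n ∸ 1)) (N₀ S)) eq) ⟩
    2 ^ suc (length S)         ∎
    where open ≡-Reasoning

  extremal-resp-↭ : ∀ {S S′} → S ↭ S′ → Extremal S → Extremal S′
  extremal-resp-↭ {S} {S′} S↭S′ ext = begin
    2 ^ n * N S′ 𝟘       ≡⟨ cong (2 ^ n *_) (N-resp-↭ S↭S′ 𝟘) ⟨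
    2 ^ n * N S 𝟘        ≡⟨ ext ⟩
    2 ^ suc (length S)   ≡⟨ cong (λ k → 2 ^ suc k) (↭-length S↭S′) ⟩
    2 ^ suc (length S′)  ∎
    where open ≡-Reasoning

  extremal-tail : ∀ {x L} → Extremal (x ∷ L) → 1 ≤ N L (𝟘 ⊖ x) → Extremal L
  extremal-tail {x} {L} ext 1≤N = m≤n⇒m≤o⇒n+o≡m+m⇒n≡m
    (N-lower-bound-n L (1≤N-𝟘 L)) (N-lower-bound-n L 1≤N) (begin
      2 ^ n * N L 𝟘 + 2 ^ n * N L (𝟘 ⊖ x)      ≡⟨ *-distribˡ-+ (2 ^ n) (N L 𝟘) (N L (𝟘 ⊖ x)) ⟨
      2 ^ n * N (x ∷ L) 𝟘                      ≡⟨ ext ⟩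
      2 * 2 ^ suc (length L)                   ≡⟨ 2*m≡m+m (2 ^ suc (length L)) ⟩
      2 ^ suc (length L) + 2 ^ suc (length L)  ∎)
    where open ≡-Reasoning

  extremal-exchange : ∀ {x a m} → x ≢ 𝟘 → Extremal (x ∷ replicate (suc m) a) →
                      1 ≤ N (replicate (suc m) a) (𝟘 ⊖ x) → Extremal (x ∷ replicate m a)
  extremal-exchange {x} {a} {m} x≢𝟘 ext 1≤N = extremal-tail {a} {x ∷ replicate m a}
    (extremal-resp-↭ (↭.swap x a (↭.refl {xs = replicate m a})) ext)
    (≤-trans (subst (λ u → 1 ≤ N (replicate m a) u) (⊖-swap 𝟘 x a) (N-replicate-peel m a 𝟘⊖x≢𝟘 1≤N))
             (N-∷ʳ x (replicate m a) (𝟘 ⊖ a)))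
    where
    𝟘⊖x≢𝟘 : 𝟘 ⊖ x ≢ 𝟘
    𝟘⊖x≢𝟘 = x≢𝟘 ∘ from ≡⇔⊖≡𝟘

  zsf-extremal⇒length : ∀ {S} → ZeroSumFree S → Extremal S → n ≡ suc (length S)
  zsf-extremal⇒length {S} zsf ext = 2^-injective (begin
    2 ^ n               ≡⟨ *-identityʳ (2 ^ n) ⟨
    2 ^ n * 1           ≡⟨ cong (2 ^ n *_) zsf ⟨
    2 ^ n * N S 𝟘       ≡⟨ ext ⟩
    2 ^ suc (length S)  ∎)
    where open ≡-Reasoning

  -- N (a^(n+1)) 𝟘 ≥ 2 + n, as a^n has the sum 𝟘 twice and the sum −a n times; extremality forces 4.
  ¬extremal-replicate-suc-n : 3 ≤ n → ∀ a → ¬ Extremal (replicate (suc n) a)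
  ¬extremal-replicate-suc-n 3≤n a ext = 1+n≰n (begin
    5                          ≤⟨ s≤s (s≤s 3≤n) ⟩
    2 + n                      ≤⟨ +-mono-≤ 2≤N[aⁿ]𝟘 n≤N[aⁿ][𝟘⊖a] ⟩
    N (replicate (suc n) a) 𝟘  ≡⟨ *-cancelˡ-≡ _ 4 (2 ^ n) {{m^n≢0 2 n}} 2ⁿ*N≡2ⁿ*4 ⟩
    4                          ∎)
    where
    open ≤-Reasoning
    2≤N[aⁿ]𝟘 : 2 ≤ N (replicate n a) 𝟘
    2≤N[aⁿ]𝟘 = 2≤N-replicate n a (>-nonZero⁻¹ n) ≤-refl (n·a≡𝟘 a)
    n≤N[aⁿ][𝟘⊖a] : n ≤ N (replicate n a) (𝟘 ⊖ a)
    n≤N[aⁿ][𝟘⊖a] = subst₂ (λ k u → k ≤ N (replicate k a) u) suc[n∸1]≡n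
      (trans ([n∸1]·a≡⊖a a) (sym (⊕-identityˡ (⊖ a)))) (N-replicate-drop-one (n ∸ 1) a)
    2ⁿ*N≡2ⁿ*4 : 2 ^ n * N (replicate (suc n) a) 𝟘 ≡ 2 ^ n * 4
    2ⁿ*N≡2ⁿ*4 = trans ext (trans (cong (λ k → 2 ^ suc (suc k)) (length-replicate n))
                                 (trans (sym (*-assoc 2 2 (2 ^ n))) (*-comm 4 (2 ^ n))))

  find-zero-sum-term : ∀ S → 2 ≤ N S 𝟘 → ∃[ x ] ∃[ L ] S ↭ x ∷ L × 1 ≤ N L (𝟘 ⊖ x)
  find-zero-sum-term []      2≤N = ⊥-elim (1+n≰n (subst (2 ≤_) N[]𝟘≡1 2≤N))
  find-zero-sum-term (g ∷ S) 2≤N with 1 ≤? N S (𝟘 ⊖ g)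
  ... | yes 1≤N = g , S , ↭.refl , 1≤N
  ... | no  1≰N with x , L , S↭x∷L , 1≤N ← find-zero-sum-term S (k≤m+n∧1≰n⇒k≤m 2≤N 1≰N) =
    x , g ∷ L , ↭.trans (↭.prep g S↭x∷L) (↭.swap g x ↭.refl) , ≤-trans 1≤N (N-∷ˡ g L (𝟘 ⊖ x))

  ExtremalShape : ℕ → Seq n → Set
  ExtremalShape k S = (k ≡ n ∸ 1 ⊎ k ≡ n) × ∃[ a ] Generates a × S ≡ replicate k a

  ExtremalShapeAt : ℕ → Set
  ExtremalShapeAt k = ∀ S → length S ≡ k → All (_≢ 𝟘) S → Extremal S → ExtremalShape k S

  shape-length⇒2≤ : 3 ≤ n → ∀ {k} → k ≡ n ∸ 1 ⊎ k ≡ n → 2 ≤ k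
  shape-length⇒2≤ 3≤n (inj₁ refl) = ≤-pred (subst (3 ≤_) (sym suc[n∸1]≡n) 3≤n)
  shape-length⇒2≤ 3≤n (inj₂ refl) = ≤-trans (s≤s (s≤s z≤n)) 3≤n

  shape-length⇒bounds : ∀ {k} → k ≡ n ∸ 1 ⊎ k ≡ n → n ∸ 1 ≤ k × k ≤ n
  shape-length⇒bounds (inj₁ refl) = ≤-refl , m∸n≤m n 1
  shape-length⇒bounds (inj₂ refl) = m∸n≤m n 1 , ≤-refl

  extremal-replicate-length : 3 ≤ n → ∀ {k a} → k ≡ n ∸ 1 ⊎ k ≡ n → Extremal (replicate (suc k) a) →
                              suc k ≡ n ∸ 1 ⊎ suc k ≡ n
  extremal-replicate-length _   (inj₁ refl) _ = inj₂ suc[n∸1]≡n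
  extremal-replicate-length 3≤n {a = a} (inj₂ refl) ext = ⊥-elim (¬extremal-replicate-suc-n 3≤n a ext)

  zsf-extremal⇒shape : 3 ≤ n → ∀ S → All (_≢ 𝟘) S → ZeroSumFree S → Extremal S → ExtremalShape (length S) S
  zsf-extremal⇒shape 3≤n [] _ zsf ext with s≤s () ← subst (3 ≤_) (zsf-extremal⇒length {[]} zsf ext) 3≤n
  zsf-extremal⇒shape 3≤n (x ∷ R) S≢𝟘 zsf ext =
    inj₁ |S|≡n∸1 , x , zsf-replicate⇒generates x zsf′ , S≡xˢ
    where
    n≡1+|S| : n ≡ suc (length (x ∷ R))
    n≡1+|S| = zsf-extremal⇒length {x ∷ R} zsf ext
    |S|≡n∸1 : length (x ∷ R) ≡ n ∸ 1
    |S|≡n∸1 = cong (_∸ 1) (sym n≡1+|S|)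
    S≡xˢ : x ∷ R ≡ replicate (length (x ∷ R)) x
    S≡xˢ = All-≡⇒≡replicate (zsf-constant S≢𝟘 zsf (sym n≡1+|S|))
    zsf′ : ZeroSumFree (replicate (n ∸ 1) x)
    zsf′ = subst (λ k → ZeroSumFree (replicate k x)) |S|≡n∸1 (subst ZeroSumFree S≡xˢ zsf)

  head-joins-constant : ∀ {m x a} → ExtremalShapeAt (2 + m) → x ≢ 𝟘 → a ≢ 𝟘 →
                        Extremal (x ∷ replicate (2 + m) a) → 1 ≤ N (replicate (2 + m) a) (𝟘 ⊖ x) → x ≡ a
  head-joins-constant {m} {x} {a} IH x≢𝟘 a≢𝟘 ext 1≤N
    with _ , _ , _ , x∷aᵐ⁺¹≡bᵐ⁺² ← IH (x ∷ replicate (suc m) a) (cong (2 +_) (length-replicate m))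
                                      (x≢𝟘 ∷ replicate⁺ (suc m) a≢𝟘) (extremal-exchange {m = suc m} x≢𝟘 ext 1≤N)
    = trans (∷-injectiveˡ x∷aᵐ⁺¹≡bᵐ⁺²) (sym (∷-injectiveˡ (∷-injectiveʳ x∷aᵐ⁺¹≡bᵐ⁺²)))

  extremal-step : 3 ≤ n → ∀ {k} → ExtremalShapeAt k → ∀ S → length S ≡ suc k → All (_≢ 𝟘) S →
                  Extremal S → 2 ≤ N S 𝟘 → ExtremalShape (suc k) S
  extremal-step 3≤n {k} IH S len S≢𝟘 ext 2≤N
    with x , L , S↭x∷L , 1≤N ← find-zero-sum-term S 2≤N
    with x≢𝟘 ∷ L≢𝟘 ← All-resp-↭ S↭x∷L S≢𝟘
    with ext′ ← extremal-resp-↭ S↭x∷L ext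
    with k≡ , a , gen , refl ← IH L (suc-injective (trans (sym (↭-length S↭x∷L)) len)) L≢𝟘
                                    (extremal-tail {x} {L} ext′ 1≤N)
    with m , refl ← m≤n⇒∃[o]m+o≡n (shape-length⇒2≤ 3≤n k≡)
    with refl ← head-joins-constant IH x≢𝟘 (All.head L≢𝟘) ext′ 1≤N
    with S≡aᵏ⁺¹ ← ↭-replicate⇒≡ (suc k) S↭x∷L
    = extremal-replicate-length 3≤n k≡ (subst Extremal S≡aᵏ⁺¹ ext) , x , gen , S≡aᵏ⁺¹

  extremal⇒shape : 3 ≤ n → ∀ k → ExtremalShapeAt k
  extremal⇒shape 3≤n k S len S≢𝟘 ext with N S 𝟘 ℕ.≟ 1
  ... | yes zsf = subst (λ j → ExtremalShape j S) len (zsf-extremal⇒shape 3≤n S S≢𝟘 zsf ext)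
  extremal⇒shape 3≤n zero    []  _   _   _   | no ¬zsf = ⊥-elim (¬zsf N[]𝟘≡1)
  extremal⇒shape 3≤n (suc k) S   len S≢𝟘 ext | no ¬zsf =
    extremal-step 3≤n (extremal⇒shape 3≤n k) S len S≢𝟘 ext (≤∧≢⇒< (1≤N-𝟘 S) (¬zsf ∘ sym))

theorem3p4 : (n : ℕ) .{{_ : NonZero n}} → 3 ≤ n → (S : Seq n) → 𝟘 ∉ S →
    N₀ S * 2 ^ (n ∸ 1) ≡ 2 ^ length S →
    (n ∸ 1 ≤ length S) × (length S ≤ n) × (∃[ a ] (Generates a × S ≡ replicate (length S) a))
theorem3p4 n 3≤n S 𝟘∉S equation
  with length≡ , a , gen , S≡aˢ ← extremal⇒shape 3≤n (length S) S refl
                                    (All.map (_∘ sym) (¬Any⇒All¬ S 𝟘∉S)) (N₀-equation⇒extremal S equation)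
  with n∸1≤|S| , |S|≤n ← shape-length⇒bounds length≡
  = n∸1≤|S| , |S|≤n , a , gen , S≡aˢ
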